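{- If $G$ is a connected graph that is a tree, a cycle, a complete graph, or a complete bipartite graph, then every graph search ordering of $G$ is an MNS ordering of $G$.
   Context: All graphs are finite and simple. For an ordering $\sigma$ of $V(G)$ write $x<_\sigma y$ if $x$ precedes $y$. A graph search ordering of $G$ is an ordering of $V(G)$ such that every prefix induces a connected subgraph. $\sigma$ is an MNS ordering if whenever $a<_\sigma b<_\sigma c$, $ac\in E(G)$ and $ab\notin E(G)$, there is $d$ with $d<_\sigma b$, $db\in E(G)$ and $dc\notin E(G)$. -}

module Defs where

open import Data.Nat using (ℕ; zero; suc; _+_; _<_; _≤_)
open import Data.Fin using (Fin; toℕ; inject₁; fromℕ) renaming (zero to fzero; suc to fsuc)
open import Data.Bool using (Bool; true; false)
open import Data.Product using (Σ; ∃; _×_; _,_)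
open import Data.Sum using (_⊎_)
open import Data.Unit using (⊤)
open import Relation.Nullary using (¬_)
open import Relation.Binary.PropositionalEquality using (_≡_; _≢_)
open import Function.Definitions using (Injective)
open import Function.Bundles using (_⇔_)
open import Data.Fin.Permutation using (Permutation′; _⟨$⟩ʳ_)

record Graph (n : ℕ) : Set where
  field
    adj   : Fin n → Fin n → Bool
    sym   : ∀ x y → adj x y ≡ adj y x
    irrefl : ∀ x → adj x x ≡ false

open Graph public

E : ∀ {n} → Graph n → Fin n → Fin n → Set
E G x y = adj G x y ≡ true

-- Walks from x to y all of whose vertices after x satisfy P
data Walk {n} (G : Graph n) (P : Fin n → Set) : Fin n → Fin n → Set where
  here : ∀ {x} → Walk G P x x
  step : ∀ {x z y} → E G x z → P z → Walk G P z y → Walk G P x y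

InducedConnected : ∀ {n} → Graph n → (Fin n → Set) → Set
InducedConnected G P = ∀ x y → P x → P y → Walk G P x y

Connected : ∀ {n} → Graph n → Set
Connected G = InducedConnected G (λ _ → ⊤)

HasCycle : ∀ {n} → Graph n → Set
HasCycle {n} G =
  Σ ℕ λ k → Σ (Fin (suc (suc (suc k))) → Fin n) λ c →
    Injective _≡_ _≡_ c
    × (∀ (i : Fin (suc (suc k))) → E G (c (inject₁ i)) (c (fsuc i)))
    × E G (c (fromℕ (suc (suc k)))) (c fzero)

IsTree : ∀ {n} → Graph n → Set
IsTree G = Connected G × ¬ HasCycle G

CycNext : ∀ {n} → Fin n → Fin n → Set
CycNext {n} i j = suc (toℕ i) ≡ toℕ j ⊎ (suc (toℕ i) ≡ n × toℕ j ≡ 0)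

IsCycle : ∀ {n} → Graph n → Set
IsCycle {n} G = 3 ≤ n × Σ (Permutation′ n) λ f →
  ∀ i j → E G (f ⟨$⟩ʳ i) (f ⟨$⟩ʳ j) ⇔ (CycNext i j ⊎ CycNext j i)

IsComplete : ∀ {n} → Graph n → Set
IsComplete G = ∀ x y → x ≢ y → E G x y

IsCompleteBipartite : ∀ {n} → Graph n → Set
IsCompleteBipartite {n} G = Σ (Fin n → Bool) λ c →
  (∃ λ x → c x ≡ true) × (∃ λ x → c x ≡ false) ×
  (∀ x y → E G x y ⇔ c x ≢ c y)

-- An ordering σ of V(G): σ ⟨$⟩ʳ i is the vertex in position i.
Ordering : ℕ → Set
Ordering n = Permutation′ n

IsGraphSearch : ∀ {n} → Graph n → Ordering n → Set
IsGraphSearch {n} G σ =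
  ∀ (m : ℕ) → InducedConnected G (λ v → Σ (Fin n) λ i → toℕ i < m × σ ⟨$⟩ʳ i ≡ v)

-- MNS condition, stated on positions (σ is a bijection):
-- a = σ i, b = σ j, c = σ k with i < j < k
IsMNS : ∀ {n} → Graph n → Ordering n → Set
IsMNS {n} G σ = ∀ (i j k : Fin n) → toℕ i < toℕ j → toℕ j < toℕ k →
  E G (σ ⟨$⟩ʳ i) (σ ⟨$⟩ʳ k) → ¬ E G (σ ⟨$⟩ʳ i) (σ ⟨$⟩ʳ j) →
  Σ (Fin n) λ l → toℕ l < toℕ j × E G (σ ⟨$⟩ʳ l) (σ ⟨$⟩ʳ j) × ¬ E G (σ ⟨$⟩ʳ l) (σ ⟨$⟩ʳ k)

-- Let a <σ b <σ c with ac ∈ E and ab ∉ E.  Since the prefix ending in b is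
-- connected, b has an earlier neighbour d, and d ≠ a.  If d were adjacent to c,
-- then a and d would be two neighbours of c joined by a walk through the
-- vertices before b, which avoids both b and c.  In a tree this walk closes a
-- cycle through c; in a cycle the only such walk runs through every vertex
-- other than c, b included; in a complete graph a is adjacent to b; and in a
-- complete bipartite graph a and d lie on the same side, opposite to b, so
-- again a is adjacent to b.  Hence d is not adjacent to c, as MNS requires.
module Submission where

open import Defs hiding (sym)
open import Data.Nat using (ℕ; suc; _+_; _∸_; _<_; _≤_; _<?_; z≤n; s≤s; s≤s⁻¹)
open import Data.Nat.Properties
  using (≤-antisym; ≤-trans; ≤-refl; ≤-reflexive; <-irrefl; <-asym; n≮n; ≤-<-trans; <-≤-trans;
         <⇒≤; <⇒≱; ≮⇒≥; ≤∧≢⇒<; n<1+n; n≤1+n; m<n⇒m<1+n; m≤n+m; m<m+n; n≤0⇒n≡0;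
         m∸n+n≡m; suc-injective; +-suc; +-comm; +-cancelʳ-≡; +-cancelʳ-≤; +-monoˡ-≤; module ≤-Reasoning)
  renaming (_≟_ to _≟ℕ_)
open import Data.Fin using (Fin; toℕ; inject₁; fromℕ; _≟_) renaming (zero to fzero; suc to fsuc)
open import Data.Fin.Properties using (toℕ-injective; toℕ<n)
open import Data.Fin.Permutation using (Permutation′; _⟨$⟩ʳ_; _⟨$⟩ˡ_; inverseʳ; flip)
open import Data.Bool.Properties using (¬-not)
open import Data.Vec using (Vec; []; _∷_; lookup)
open import Data.Vec.Relation.Unary.All as All using (All; []; _∷_)
open import Data.Vec.Relation.Unary.AllPairs using ([]; _∷_)
open import Data.Vec.Relation.Unary.Unique.Propositional using (Unique)
open import Data.Vec.Relation.Unary.Unique.Propositional.Properties using (lookup-injective)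
open import Data.Product using (Σ; ∃-syntax; _×_; _,_)
open import Data.Sum using (_⊎_; inj₁; inj₂)
import Data.Sum as Sum
open import Relation.Nullary using (¬_; yes; no; contradiction)
open import Relation.Binary.PropositionalEquality
  using (_≡_; _≢_; refl; sym; trans; cong; subst; subst₂; module ≡-Reasoning)
open import Function.Bundles using (Injection; Equivalence; _⇔_)
open import Function.Properties.Inverse using (↔⇒↣)

private
  variable
    n k m : ℕ
    G : Graph n
    P : Fin n → Set
    a b c d u v x y z : Fin n

E-sym : ∀ (G : Graph n) → E G x y → E G y x
E-sym {x = x} {y} G e = trans (Graph.sym G y x) e

E⇒≢ : ∀ (G : Graph n) → E G x y → x ≢ y
E⇒≢ {x = x} G e refl with trans (sym e) (irrefl G x)
... | ()

walk-first-step : Walk G P x y → x ≢ y → ∃[ z ] P z × E G x z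
walk-first-step here x≢x = contradiction refl x≢x
walk-first-step (step e pz _) _ = _ , pz , e

walk-snoc : Walk G P x y → E G y z → P z → Walk G P x z
walk-snoc here e pz = step e pz here
walk-snoc (step e pw w) e′ pz = step e pw (walk-snoc w e′ pz)

walk-reverse : P x → Walk G P x y → Walk G P y x
walk-reverse px here = here
walk-reverse {G = G} px (step e pz w) = walk-snoc (walk-reverse pz w) (E-sym G e) px

walk-intermediate-value : (h : Fin n → ℕ) →
  (∀ {u v} → P u → P v → E G u v → h v ≤ suc (h u)) →
  Walk G P x y → P x → h x ≤ m → m ≤ h y → ∃[ v ] P v × h v ≡ m
walk-intermediate-value h h-step here px hx≤m m≤hy = _ , px , ≤-antisym hx≤m m≤hy
walk-intermediate-value {x = x} {m = m} h h-step (step e pz w) px hx≤m m≤hy with h x ≟ℕ m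
... | yes hx≡m = x , px , hx≡m
... | no hx≢m =
  walk-intermediate-value h h-step w pz (≤-trans (h-step px pz e) (≤∧≢⇒< hx≤m hx≢m)) m≤hy

data Chain (G : Graph n) : Fin n → Vec (Fin n) k → Fin n → Set where
  []  : Chain G x [] x
  _∷_ : {vs : Vec (Fin n) k} → E G x z → Chain G z vs y → Chain G x (z ∷ vs) y

chain-edge : {vs : Vec (Fin n) k} → Chain G x vs y →
  ∀ i → E G (lookup (x ∷ vs) (inject₁ i)) (lookup (x ∷ vs) (fsuc i))
chain-edge (e ∷ _) fzero = e
chain-edge (_ ∷ ch) (fsuc i) = chain-edge ch i

chain-last : {vs : Vec (Fin n) k} → Chain G x vs y → lookup (x ∷ vs) (fromℕ k) ≡ y
chain-last [] = refl
chain-last (_ ∷ ch) = chain-last ch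

record Path (G : Graph n) (P : Fin n → Set) (x y : Fin n) : Set where
  constructor path
  field
    {length} : ℕ
    after    : Vec (Fin n) length
    chain    : Chain G x after y
    unique   : Unique (x ∷ after)
    inside   : All P after

suffix-or-avoid : ∀ x {vs : Vec (Fin n) k} → Chain G z vs y → Unique (z ∷ vs) → All P vs →
  Path G P x y ⊎ All (x ≢_) (z ∷ vs)
suffix-or-avoid {z = z} x [] u [] with x ≟ z
... | yes refl = inj₁ (path [] [] u [])
... | no x≢z = inj₂ (x≢z ∷ [])
suffix-or-avoid {z = z} x (e ∷ ch) u@(_ ∷ u′) (pw ∷ ps) with x ≟ z
... | yes refl = inj₁ (path _ (e ∷ ch) u (pw ∷ ps))
... | no x≢z = Sum.map₂ (x≢z ∷_) (suffix-or-avoid x ch u′ ps)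

walk⇒path : Walk G P x y → Path G P x y
walk⇒path here = path [] [] ([] ∷ []) []
walk⇒path {x = x} (step e pz w) with walk⇒path w
... | path vs ch u ps with suffix-or-avoid x ch u ps
...   | inj₁ p = p
...   | inj₂ x∉ = path (_ ∷ vs) (e ∷ ch) (x∉ ∷ u) (pz ∷ ps)

path-closes-cycle : ¬ P c → E G x c → E G y c → x ≢ y → Path G P x y → HasCycle G
path-closes-cycle _ _ _ x≢y (path [] [] _ _) = contradiction refl x≢y
path-closes-cycle {P = P} {c = c} {G = G} {x = x} {y = y} c∉P xc yc _
                  (path {suc ℓ} vs@(_ ∷ _) ch u ps) =
  ℓ , lookup cyc , (λ {i} {j} → lookup-injective cyc-unique i j) ,
  chain-edge cyc-chain , subst (λ w → E G w c) (sym (chain-last cyc-chain)) yc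
  where
  cyc = c ∷ x ∷ vs
  cyc-chain : Chain G c (x ∷ vs) y
  cyc-chain = E-sym G xc ∷ ch
  cyc-unique : Unique cyc
  cyc-unique = (E⇒≢ G (E-sym G xc) ∷ All.map (λ pw c≡w → c∉P (subst P (sym c≡w) pw)) ps) ∷ u

SuccMod : ℕ → ℕ → ℕ → Set
SuccMod n s t = suc s ≡ t ⊎ (suc s ≡ n × t ≡ 0)

-- rot t is the position of t when 0, 1, …, n-1 is read cyclically starting just after p.
module Rotation (n p : ℕ) (p<n : p < n) where

  rot : ℕ → ℕ
  rot t with p <? t
  ... | yes _ = t ∸ suc p
  ... | no _  = t + n ∸ suc p

  rot-spec : ∀ t → (p < t × rot t + suc p ≡ t) ⊎ (t ≤ p × rot t + suc p ≡ t + n)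
  rot-spec t with p <? t
  ... | yes p<t = inj₁ (p<t , m∸n+n≡m p<t)
  ... | no p≮t  = inj₂ (≮⇒≥ p≮t , m∸n+n≡m (≤-trans p<n (m≤n+m n t)))

  private
    shift : ∀ s t → rot t + suc p ≡ suc (rot s + suc p) → rot t ≡ suc (rot s)
    shift s t = +-cancelʳ-≡ (suc p) (rot t) (suc (rot s))

  rot-suc : ∀ {s t} → SuccMod n s t → s ≢ p → rot t ≡ suc (rot s)
  rot-suc {s} (inj₁ refl) s≢p with rot-spec s | rot-spec (suc s)
  ... | inj₁ (_ , e) | inj₁ (_ , e′) = shift s (suc s) (trans e′ (cong suc (sym e)))
  ... | inj₂ (_ , e) | inj₂ (_ , e′) = shift s (suc s) (trans e′ (cong suc (sym e)))
  ... | inj₁ (p<s , _) | inj₂ (s<p , _) = contradiction s<p (<-asym p<s)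
  ... | inj₂ (s≤p , _) | inj₁ (p<1+s , _) = contradiction (≤-antisym s≤p (s≤s⁻¹ p<1+s)) s≢p
  rot-suc {s} (inj₂ (1+s≡n , refl)) s≢p with rot-spec s | rot-spec 0
  ... | _ | inj₁ (() , _)
  ... | inj₁ (_ , e) | inj₂ (_ , e₀) = shift s 0 (trans e₀ (trans (sym 1+s≡n) (cong suc (sym e))))
  ... | inj₂ (s≤p , _) | inj₂ _ =
    contradiction (subst (_≤ p) 1+s≡n (≤∧≢⇒< s≤p s≢p)) (<⇒≱ p<n)

  rot-after-p : ∀ {t} → SuccMod n p t → rot t ≡ 0
  rot-after-p (inj₁ refl) with rot-spec (suc p)
  ... | inj₁ (_ , e) = +-cancelʳ-≡ (suc p) _ 0 e
  ... | inj₂ (1+p≤p , _) = contradiction 1+p≤p (n≮n p)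
  rot-after-p (inj₂ (1+p≡n , refl)) with rot-spec 0
  ... | inj₁ (() , _)
  ... | inj₂ (_ , e) = +-cancelʳ-≡ (suc p) _ 0 (trans e (sym 1+p≡n))

  rot-before-p : ∀ {s} → SuccMod n s p → s ≢ p → suc (suc (rot s)) ≡ n
  rot-before-p {s} (inj₁ 1+s≡p) _ with rot-spec s
  ... | inj₁ (p<s , _) = contradiction (subst (_< s) (sym 1+s≡p) p<s) (<-asym (n<1+n s))
  ... | inj₂ (_ , e) = +-cancelʳ-≡ s _ _ (begin
    suc (suc (rot s)) + s   ≡⟨ sym (trans (+-suc (rot s) (suc s)) (cong suc (+-suc (rot s) s))) ⟩
    rot s + suc (suc s)     ≡⟨ cong (λ q → rot s + suc q) 1+s≡p ⟩
    rot s + suc p           ≡⟨ e ⟩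
    s + n                   ≡⟨ +-comm s n ⟩
    n + s                   ∎)
    where open ≡-Reasoning
  rot-before-p {s} (inj₂ (1+s≡n , p≡0)) s≢p with rot-spec s
  ... | inj₁ (_ , e) =
    trans (cong suc (trans (+-comm 1 (rot s)) (subst (λ q → rot s + suc q ≡ s) p≡0 e))) 1+s≡n
  ... | inj₂ (s≤p , _) = contradiction (trans (n≤0⇒n≡0 (subst (s ≤_) p≡0 s≤p)) (sym p≡0)) s≢p

  rot-bound : ∀ {s} → s < n → s ≢ p → suc (rot s) < n
  rot-bound {s} s<n s≢p with rot-spec s
  ... | inj₁ (_ , e) = ≤-<-trans (m<m+n (rot s) (s≤s z≤n)) (subst (_< n) (sym e) s<n)
  ... | inj₂ (s≤p , e) = +-cancelʳ-≤ p _ _ (begin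
    suc (suc (rot s)) + p   ≡⟨ cong suc (sym (+-suc (rot s) p)) ⟩
    suc (rot s + suc p)     ≡⟨ cong suc e ⟩
    suc s + n               ≤⟨ +-monoˡ-≤ n (≤∧≢⇒< s≤p s≢p) ⟩
    p + n                   ≡⟨ +-comm p n ⟩
    n + p                   ∎)
    where open ≤-Reasoning

  rot-injective : ∀ {s t} → s < n → t < n → rot s ≡ rot t → s ≡ t
  rot-injective {s} {t} s<n t<n eq with rot-spec s | rot-spec t
  ... | inj₁ (_ , e) | inj₁ (_ , e′) = trans (sym e) (trans (cong (_+ suc p) eq) e′)
  ... | inj₂ (_ , e) | inj₂ (_ , e′) =
    +-cancelʳ-≡ n _ _ (trans (sym e) (trans (cong (_+ suc p) eq) e′))
  ... | inj₁ (_ , e) | inj₂ (_ , e′) = contradiction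
    (subst (n ≤_) (trans (sym e′) (trans (cong (_+ suc p) (sym eq)) e)) (m≤n+m n t)) (<⇒≱ s<n)
  ... | inj₂ (_ , e) | inj₁ (_ , e′) = contradiction
    (subst (n ≤_) (trans (sym e) (trans (cong (_+ suc p) eq) e′)) (m≤n+m n s)) (<⇒≱ t<n)

-- The height of a vertex is the rotated position of its label, so that the
-- neighbours of c sit at the two ends 0 and n-2 of the path left after deleting c.
module CycleHeight {G : Graph n} (f : Permutation′ n)
  (f-adj : ∀ i j → E G (f ⟨$⟩ʳ i) (f ⟨$⟩ʳ j) ⇔ (CycNext i j ⊎ CycNext j i)) (c : Fin n) where

  label : Fin n → Fin n
  label v = f ⟨$⟩ˡ v

  open Rotation n (toℕ (label c)) (toℕ<n (label c))

  height : Fin n → ℕ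
  height v = rot (toℕ (label v))

  label-injective : label u ≡ label v → u ≡ v
  label-injective = Injection.injective (↔⇒↣ (flip f))

  label-≢ : u ≢ c → toℕ (label u) ≢ toℕ (label c)
  label-≢ u≢c eq = u≢c (label-injective (toℕ-injective eq))

  adjacent-labels : E G u v → CycNext (label u) (label v) ⊎ CycNext (label v) (label u)
  adjacent-labels e =
    Equivalence.to (f-adj _ _) (subst₂ (E G) (sym (inverseʳ f)) (sym (inverseʳ f)) e)

  height-injective : height u ≡ height v → u ≡ v
  height-injective eq = label-injective (toℕ-injective (rot-injective (toℕ<n _) (toℕ<n _) eq))

  height-step : u ≢ c → v ≢ c → E G u v → height v ≤ suc (height u)
  height-step u≢c v≢c e with adjacent-labels e
  ... | inj₁ uv = ≤-reflexive (rot-suc uv (label-≢ u≢c))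
  ... | inj₂ vu =
    ≤-trans (n≤1+n _) (≤-trans (≤-reflexive (sym (rot-suc vu (label-≢ v≢c)))) (n≤1+n _))

  height-neighbour : E G v c → height v ≡ 0 ⊎ suc (suc (height v)) ≡ n
  height-neighbour e with adjacent-labels e
  ... | inj₁ vc = inj₂ (rot-before-p vc (label-≢ (E⇒≢ G e)))
  ... | inj₂ cv = inj₁ (rot-after-p cv)

  height-bound : v ≢ c → suc (height v) < n
  height-bound v≢c = rot-bound (toℕ<n _) (label-≢ v≢c)

cycle-walk-covers : IsCycle G → ¬ P c → P a → P d → a ≢ d → E G a c → E G d c →
  Walk G P a d → b ≢ c → P b
cycle-walk-covers {n} {G} {P} {c} {a} {d} {b} (_ , f , f-adj) c∉P pa pd a≢d ac dc walk b≢c =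
  ends (height-neighbour ac) (height-neighbour dc)
  where
  open CycleHeight {G = G} f f-adj c

  P⇒≢c : P v → v ≢ c
  P⇒≢c pv refl = c∉P pv

  climb : Walk G P x y → P x → height x ≡ 0 → suc (suc (height y)) ≡ n → P b
  climb w px hx hy
    with walk-intermediate-value height (λ pu pv → height-step (P⇒≢c pu) (P⇒≢c pv)) w px
           (subst (_≤ height b) (sym hx) z≤n)
           (s≤s⁻¹ (s≤s⁻¹ (subst (suc (suc (height b)) ≤_) (sym hy) (height-bound b≢c))))
  ... | _ , pv , hv≡hb = subst P (height-injective hv≡hb) pv

  ends : height a ≡ 0 ⊎ suc (suc (height a)) ≡ n →
         height d ≡ 0 ⊎ suc (suc (height d)) ≡ n → P b
  ends (inj₁ ha) (inj₁ hd) = contradiction (height-injective (trans ha (sym hd))) a≢d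
  ends (inj₂ ha) (inj₂ hd) =
    contradiction (height-injective (suc-injective (suc-injective (trans ha (sym hd))))) a≢d
  ends (inj₁ ha) (inj₂ hd) = climb walk pa ha hd
  ends (inj₂ ha) (inj₁ hd) = climb (walk-reverse pa walk) pd hd ha

complete-bipartite-shortcut : ∀ (G : Graph n) → IsCompleteBipartite G →
  E G a c → E G d c → E G d b → E G a b
complete-bipartite-shortcut {a = a} {c} {d} {b} G (colour , _ , _ , E⇔) ac dc db =
  Equivalence.from (E⇔ a b) λ a≡b → Equivalence.to (E⇔ d b) db (trans (sym a≡d) a≡b)
  where
  a≡d : colour a ≡ colour d
  a≡d = trans (¬-not (Equivalence.to (E⇔ a c) ac)) (sym (¬-not (Equivalence.to (E⇔ d c) dc)))

Before : Ordering n → ℕ → Fin n → Set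
Before {n} σ m v = Σ (Fin n) λ i → toℕ i < m × σ ⟨$⟩ʳ i ≡ v

module _ (σ : Ordering n) where

  position-≢ : ∀ {i j} → toℕ i < toℕ j → σ ⟨$⟩ʳ i ≢ σ ⟨$⟩ʳ j
  position-≢ i<j eq = <-irrefl (cong toℕ (Injection.injective (↔⇒↣ σ) eq)) i<j

  not-Before : ∀ {i} → m ≤ toℕ i → ¬ Before σ m (σ ⟨$⟩ʳ i)
  not-Before m≤i (_ , l<m , eq) = position-≢ (<-≤-trans l<m m≤i) eq

  search⇒earlier-neighbour : IsGraphSearch G σ → ∀ {i j} → toℕ i < toℕ j →
    ∃[ l ] toℕ l < toℕ j × E G (σ ⟨$⟩ʳ l) (σ ⟨$⟩ʳ j)
  search⇒earlier-neighbour {G = G} search {i} {j} i<j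
    with walk-first-step (search (suc (toℕ j)) _ _ (j , ≤-refl , refl) (i , m<n⇒m<1+n i<j , refl))
                         (λ eq → position-≢ i<j (sym eq))
  ... | _ , (l , l≤j , refl) , e =
    l , ≤∧≢⇒< (s≤s⁻¹ l≤j) (λ l≡j → E⇒≢ G e (cong (σ ⟨$⟩ʳ_) (toℕ-injective (sym l≡j)))) ,
    E-sym G e

lemma8 : ∀ {n : ℕ} (G : Graph n) → Connected G →
    (IsTree G ⊎ IsCycle G ⊎ IsComplete G ⊎ IsCompleteBipartite G) →
    ∀ (σ : Ordering n) → IsGraphSearch G σ → IsMNS G σ
lemma8 G _ classes σ search i j k i<j j<k ac ¬ab with search⇒earlier-neighbour σ search i<j
... | l , l<j , db = l , l<j , db , shortcut classes
  where
  walk : Walk G (Before σ (toℕ j)) (σ ⟨$⟩ʳ i) (σ ⟨$⟩ʳ l)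
  walk = search (toℕ j) _ _ (i , i<j , refl) (l , l<j , refl)

  a≢d : σ ⟨$⟩ʳ i ≢ σ ⟨$⟩ʳ l
  a≢d a≡d = ¬ab (subst (λ w → E G w (σ ⟨$⟩ʳ j)) (sym a≡d) db)

  shortcut : IsTree G ⊎ IsCycle G ⊎ IsComplete G ⊎ IsCompleteBipartite G →
    ¬ E G (σ ⟨$⟩ʳ l) (σ ⟨$⟩ʳ k)
  shortcut (inj₁ (_ , acyclic)) dc =
    acyclic (path-closes-cycle (not-Before σ (<⇒≤ j<k)) ac dc a≢d (walk⇒path walk))
  shortcut (inj₂ (inj₁ cycle)) dc =
    not-Before σ ≤-refl (cycle-walk-covers cycle (not-Before σ (<⇒≤ j<k))
      (i , i<j , refl) (l , l<j , refl) a≢d ac dc walk (position-≢ σ j<k))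
  shortcut (inj₂ (inj₂ (inj₁ complete))) _ = ¬ab (complete _ _ (position-≢ σ i<j))
  shortcut (inj₂ (inj₂ (inj₂ bipartite))) dc =
    ¬ab (complete-bipartite-shortcut G bipartite ac dc db)
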